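{- Let $m,k\geq 2$ be relatively prime integers, and let $r$ be the least nonnegative residue of $m$ modulo $k$. If $n=m-\lfloor m/k\rfloor+F(k,k-r)$, then there exists a smooth arithmetical structure on $D_n$ whose critical group has order $m$.
   Context: For $n\ge 3$ let $\ell=n-3$. The bident $D_n$ has vertices $v_x,v_y,v_0,\dots,v_\ell$ and edges $v_xv_0$, $v_yv_0$, $v_iv_{i+1}$ ($0\le i\le\ell-1$). An arithmetical structure on $D_n$ is a pair $(\mathbf d,\mathbf r)$, $\mathbf d=(d_x,d_y,d_0,\dots,d_\ell)$, of positive integer vectors with $(\operatorname{diag}(\mathbf d)-A)\mathbf r=\mathbf 0$ ($A$ the adjacency matrix) and $\mathbf r$ primitive; it is smooth if $d_x,d_y,d_1,\dots,d_\ell\ge2$. Its critical group is the torsion part of $\mathbb Z^n/\operatorname{Im}(\operatorname{diag}(\mathbf d)-A)$. The function $F:\mathbb Z_{>0}\times\mathbb Z_{\ge0}\to\mathbb Z_{>0}$: given $x_1>0$, $x_2\ge0$, for each $i\ge2$ with $x_i>0$ let $x_{i+1}$ be the least nonnegative residue of $-x_{i-1}$ modulo $x_i$; $F(x_1,x_2)$ is the number of positive terms of $(x_i)$. -}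

module Defs where

open import Data.Nat as ℕ using (ℕ; zero; suc; _≤_; _≡ᵇ_; NonZero)
open import Data.Nat.Divisibility using (_∣_)
open import Data.Nat.DivMod using (_%_)
open import Data.Integer as ℤ using (ℤ; +_; _-_; _*_; _+_)
open import Data.Fin using (Fin; toℕ)
open import Data.Bool using (if_then_else_)
open import Data.Product using (Σ; ∃; _×_)
open import Relation.Binary.PropositionalEquality using (_≡_; _≢_)

-- Fgo fuel a b : number of positive terms of the sequence starting a, b
-- (a > 0), where x_{i+1} = least nonnegative residue of -x_{i-1} mod x_i.
-- The least nonnegative residue of -a modulo b (b > 0) is (b ∸ a % b) % b.
-- The second argument strictly decreases, so fuel (suc b) is enough.

Fgo : ℕ → ℕ → ℕ → ℕ
Fgo _        a zero    = 1
Fgo zero     a (suc b) = 1   -- unreachable with sufficient fuel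
Fgo (suc f)  a (suc b) = suc (Fgo f (suc b) ((suc b ℕ.∸ (a % suc b)) % suc b))

F : ℕ → ℕ → ℕ
F x₁ x₂ = Fgo (suc x₂) x₁ x₂

-- The bident D_n, vertices indexed by Fin n:
--   index 0 = v_x, index 1 = v_y, index (i+2) = v_i  (0 ≤ i ≤ n-3).
-- Edges: v_x v_0 (0–2), v_y v_0 (1–2), v_i v_{i+1} ((i+2)–(i+3)).

edgeℕ : ℕ → ℕ → ℕ
edgeℕ 0 2 = 1
edgeℕ 1 2 = 1
edgeℕ (suc (suc a)) b = if b ≡ᵇ suc (suc (suc a)) then 1 else 0
edgeℕ _ _ = 0

adj : ∀ {n} → Fin n → Fin n → ℤ
adj i j = + (edgeℕ (toℕ i) (toℕ j) ℕ.+ edgeℕ (toℕ j) (toℕ i))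

sumℤ : ∀ {n} → (Fin n → ℤ) → ℤ
sumℤ {zero}  f = + 0
sumℤ {suc n} f = f Fin.zero + sumℤ (λ i → f (Fin.suc i))
  where import Data.Fin as Fin

lap : ∀ {n} → (Fin n → ℕ) → (Fin n → ℤ) → Fin n → ℤ
lap d z i = (+ d i) * z i - sumℤ (λ j → adj i j * z j)

Primitive : ∀ {n} → (Fin n → ℕ) → Set
Primitive {n} r = ∀ (g : ℕ) → (∀ i → g ∣ r i) → g ≡ 1

record ArithStruct (n : ℕ) : Set where
  field
    d    : Fin n → ℕ
    r    : Fin n → ℕ
    d-pos : ∀ i → 1 ≤ d i
    r-pos : ∀ i → 1 ≤ r i
    kernel : ∀ i → lap d (λ j → + r j) i ≡ + 0
    r-primitive : Primitive r

-- smooth: d_x, d_y, d_1, ..., d_ℓ ≥ 2, i.e. every vertex except v_0 (index 2)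
Smooth : ∀ {n} → ArithStruct n → Set
Smooth {n} S = ∀ (i : Fin n) → toℕ i ≢ 2 → 2 ≤ ArithStruct.d S i

-- Critical group: torsion part of ℤ^n / Im(diag(d) - A)

InIm : ∀ {n} → (Fin n → ℕ) → (Fin n → ℤ) → Set
InIm {n} d v = Σ (Fin n → ℤ) λ z → ∀ i → lap d z i ≡ v i

SameClass : ∀ {n} → (Fin n → ℕ) → (Fin n → ℤ) → (Fin n → ℤ) → Set
SameClass d u v = InIm d (λ i → u i - v i)

Torsion : ∀ {n} → (Fin n → ℕ) → (Fin n → ℤ) → Set
Torsion d v = Σ ℕ λ c → 1 ≤ c × InIm d (λ i → + c * v i)

-- the torsion subgroup has exactly m elements: there are m pairwise
-- distinct torsion classes exhausting all torsion classes
CriticalGroupOrder : ∀ {n} → ArithStruct n → ℕ → Set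
CriticalGroupOrder {n} S m =
  Σ (Fin m → (Fin n → ℤ)) λ rep →
    (∀ a → Torsion d (rep a)) ×
    (∀ a b → SameClass d (rep a) (rep b) → a ≡ b) ×
    (∀ v → Torsion d v → ∃ λ a → SameClass d v (rep a))
  where d = ArithStruct.d S

module Submission where

open import Defs

-- Write k = κ + 1, M = mκ and m = qk + r. Take d = (M, m, 1, d_1, …, d_ℓ) and
-- r = (1, κ, p_0, …, p_ℓ), where p_0 = M, p_1 = M − k, p_{i+1} = (−p_{i−1} mod p_i) is the
-- sequence whose positive terms F(M, M − k) counts, and d_i = (p_{i−1} + p_{i+1}) / p_i ≥ 2.
-- The sequence starts with the progression (m − q)k − r, (m − q − 1)k − r, …, 2k − r, so
-- F(M, M − k) = m − q − 2 + F(k, k − r), i.e. n = m − q + F(k, k − r). The critical group is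
-- cyclic of order m, generated by the class of W = (−κ, 1, 0, …, 0): m W lies in the image,
-- the rows at v_x and v_y turn aW ∼ bW into m ∣ (a − b)k, and every torsion class is reached
-- by back-substitution along the path, the row at v_x being forced because the self-adjoint
-- Laplacian kills r, so r is orthogonal to the image and to every torsion vector.

module Sequence where

  open import Data.Nat
  open import Data.Nat.Properties
  open import Data.Nat.DivMod
  open import Data.Nat.Divisibility
  open import Data.Nat.Coprimality using (Coprime)
  open import Data.Product using (_,_)
  open import Data.Empty using (⊥-elim)
  open import Data.Nat.Tactic.RingSolver using (solve-∀)
  open import Function using (_∘_)
  open import Relation.Binary.PropositionalEquality

  negMod : ℕ → ℕ → ℕ
  negMod a zero    = zero
  negMod a (suc b) = (suc b ∸ a % suc b) % suc b

  -- terms a b j is the term x_{j+1} of the sequence with x₁ = a, x₂ = b defining F a b.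
  terms : ℕ → ℕ → ℕ → ℕ
  terms a b zero    = a
  terms a b (suc j) = terms b (negMod a b) j

  negMod< : ∀ a {b} → 0 < b → negMod a b < b
  negMod< a {suc b} _ = m%n<n (suc b ∸ a % suc b) (suc b)

  ∣+negMod : ∀ a b → suc b ∣ a + negMod a (suc b)
  ∣+negMod a b = m%n≡0⇒n∣m (a + negMod a n) n (begin
    (a + negMod a n) % n            ≡⟨ %-distribˡ-+ a _ n ⟩
    (a % n + negMod a n % n) % n    ≡⟨ cong (λ x → (a % n + x) % n) (m%n%n≡m%n (n ∸ a % n) n) ⟩
    (a % n + negMod a n) % n        ≡⟨ cong (λ x → (x + negMod a n) % n) (m%n%n≡m%n a n) ⟨
    (a % n % n + negMod a n) % n    ≡⟨ %-distribˡ-+ (a % n) (n ∸ a % n) n ⟨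
    (a % n + (n ∸ a % n)) % n       ≡⟨ cong (_% n) (m+[n∸m]≡n (m%n≤n a n)) ⟩
    n % n                           ≡⟨ n%n≡0 n ⟩
    0                               ∎)
    where
    open ≡-Reasoning
    n = suc b

  negMod-+ : ∀ a b → negMod (b + a) b ≡ negMod a b
  negMod-+ a zero    = refl
  negMod-+ a (suc b) = cong (λ x → (suc b ∸ x) % suc b) (%-remove-+ˡ {suc b} a ∣-refl)

  negMod-+< : ∀ b k → 0 < k → k < b → negMod (b + k) b ≡ b ∸ k
  negMod-+< (suc b) (suc k) _ k<b = begin
    (suc b ∸ (suc b + suc k) % suc b) % suc b  ≡⟨ cong (λ x → (suc b ∸ x) % suc b) (%-remove-+ˡ {suc b} (suc k) ∣-refl) ⟩
    (suc b ∸ suc k % suc b) % suc b            ≡⟨ cong (λ x → (suc b ∸ x) % suc b) (m<n⇒m%n≡m k<b) ⟩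
    (b ∸ k) % suc b                            ≡⟨ m≤n⇒m%n≡m (m∸n≤m b k) ⟩
    b ∸ k                                      ∎
    where open ≡-Reasoning

  terms-suc-suc : ∀ a b j → terms a b (2 + j) ≡ negMod (terms a b j) (terms a b (1 + j))
  terms-suc-suc a b zero    = refl
  terms-suc-suc a b (suc j) = terms-suc-suc b (negMod a b) j

  Fgo-fuel : ∀ f g a b → b < f → b < g → Fgo f a b ≡ Fgo g a b
  Fgo-fuel f       g       a zero    _       _       = refl
  Fgo-fuel (suc f) (suc g) a (suc b) (s≤s p) (s≤s q) =
    cong suc (Fgo-fuel f g (suc b) _ (<-≤-trans (negMod< a z<s) p) (<-≤-trans (negMod< a z<s) q))

  F-suc : ∀ a {b} → 0 < b → F a b ≡ suc (F b (negMod a b))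
  F-suc a {suc b} _ = cong suc (Fgo-fuel (suc b) _ (suc b) _ (negMod< a z<s) ≤-refl)

  F-+ : ∀ a b → F (b + a) b ≡ F a b
  F-+ a zero    = refl
  F-+ a (suc b) = begin
    F (suc b + a) (suc b)                        ≡⟨ F-suc (suc b + a) z<s ⟩
    suc (F (suc b) (negMod (suc b + a) (suc b))) ≡⟨ cong (suc ∘ F (suc b)) (negMod-+ a (suc b)) ⟩
    suc (F (suc b) (negMod a (suc b)))           ≡⟨ F-suc a z<s ⟨
    F a (suc b)                                  ∎
    where open ≡-Reasoning

  Fgo-terms-pos : ∀ f a b j → b < f → 0 < a → j < Fgo f a b → 0 < terms a b j
  Fgo-terms-pos f       a b       zero    _         0<a _        = 0<a
  Fgo-terms-pos f       a zero    (suc j) _         _   (s≤s ())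
  Fgo-terms-pos (suc f) a (suc b) (suc j) (s≤s b<f) _   (s≤s j<) =
    Fgo-terms-pos f (suc b) _ j (<-≤-trans (negMod< a z<s) b<f) z<s j<

  Fgo-terms-end : ∀ f a b → b < f → terms a b (Fgo f a b) ≡ 0
  Fgo-terms-end f       a zero    _         = refl
  Fgo-terms-end (suc f) a (suc b) (s≤s b<f) = Fgo-terms-end f (suc b) _ (<-≤-trans (negMod< a z<s) b<f)

  terms-pos : ∀ a b j → 0 < a → j < F a b → 0 < terms a b j
  terms-pos a b j = Fgo-terms-pos (suc b) a b j ≤-refl

  terms-F : ∀ a b → terms a b (F a b) ≡ 0
  terms-F a b = Fgo-terms-end (suc b) a b ≤-refl

  terms-0-stable : ∀ a b j s → terms a b (suc j) ≡ 0 → terms a b (s + suc j) ≡ 0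
  terms-0-stable a b j zero    e = e
  terms-0-stable a b j (suc s) e = begin
    terms a b (suc (s + suc j))                            ≡⟨ cong (terms a b ∘ suc) (+-suc s j) ⟩
    terms a b (2 + (s + j))                                ≡⟨ terms-suc-suc a b (s + j) ⟩
    negMod (terms a b (s + j)) (terms a b (1 + (s + j)))   ≡⟨ cong (negMod (terms a b (s + j)) ∘ terms a b) (+-suc s j) ⟨
    negMod (terms a b (s + j)) (terms a b (s + suc j))     ≡⟨ cong (negMod (terms a b (s + j))) (terms-0-stable a b j s e) ⟩
    0                                                      ∎
    where open ≡-Reasoning

  F-arith : ∀ k c t → 0 < k → 0 < c → F (suc t * k + c) (t * k + c) ≡ t + F k c
  F-arith k c zero 0<k 0<c = begin
    F (k + 0 + c) c  ≡⟨ cong (λ x → F (x + c) c) (+-identityʳ k) ⟩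
    F (k + c) c      ≡⟨ cong (λ x → F x c) (+-comm k c) ⟩
    F (c + k) c      ≡⟨ F-+ k c ⟩
    F k c            ∎
    where open ≡-Reasoning
  F-arith k c (suc t) 0<k 0<c = begin
    F (suc (suc t) * k + c) x        ≡⟨ cong (λ y → F y x) (+-assoc k (suc t * k) c) ⟩
    F (k + x) x                      ≡⟨ cong (λ y → F y x) (+-comm k x) ⟩
    F (x + k) x                      ≡⟨ F-suc (x + k) (<-trans 0<k k<x) ⟩
    suc (F x (negMod (x + k) x))     ≡⟨ cong (suc ∘ F x) (negMod-+< x k 0<k k<x) ⟩
    suc (F x (x ∸ k))                ≡⟨ cong (λ y → suc (F x (y ∸ k))) (+-assoc k (t * k) c) ⟩
    suc (F x (k + (t * k + c) ∸ k))  ≡⟨ cong (suc ∘ F x) (m+n∸m≡n k (t * k + c)) ⟩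
    suc (F x (t * k + c))            ≡⟨ cong suc (F-arith k c t 0<k 0<c) ⟩
    suc (t + F k c)                  ∎
    where
    open ≡-Reasoning
    x = suc t * k + c
    k<x : k < x
    k<x = subst (k <_) (sym (+-assoc k (t * k) c)) (m<m+n k (<-≤-trans 0<c (m≤n+m c (t * k))))

  terms-suc-suc< : ∀ a b j → 0 < terms a b (1 + j) → terms a b (2 + j) < terms a b (1 + j)
  terms-suc-suc< a b j pos = subst (_< terms a b (1 + j)) (sym (terms-suc-suc a b j)) (negMod< (terms a b j) pos)

  -- ⌈ a / b ⌉, and 0 when b = 0.
  ceilDiv : ℕ → ℕ → ℕ
  ceilDiv a zero    = zero
  ceilDiv a (suc b) = (a + negMod a (suc b)) / suc b

  ceilDiv*≡ : ∀ a {b} → 0 < b → ceilDiv a b * b ≡ a + negMod a b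
  ceilDiv*≡ a {suc b} _ = m/n*n≡m (∣+negMod a b)

  2≤ceilDiv : ∀ a {b} → 0 < b → b < a → 2 ≤ ceilDiv a b
  2≤ceilDiv a {b} 0<b b<a with ceilDiv a b | ceilDiv*≡ a 0<b
  ... | 0           | e = ⊥-elim (<⇒≢ (<-trans 0<b (<-≤-trans b<a (m≤m+n a _))) e)
  ... | 1           | e = ⊥-elim (<⇒≱ b<a (≤-trans (m≤m+n a _) (≤-reflexive (trans (sym e) (*-identityˡ b)))))
  ... | suc (suc _) | _ = s≤s (s≤s z≤n)

  module Parameters (m κ : ℕ) (2≤m : 2 ≤ m) (1≤κ : 1 ≤ κ) (coprime : Coprime m (suc κ)) where

    K M q r c t : ℕ
    K = suc κ
    M = m * κ
    q = m / K
    r = m % K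
    c = K ∸ r
    t = m ∸ (2 + q)

    m≡r+q*K : m ≡ r + q * K
    m≡r+q*K = m≡m%n+[m/n]*n m K

    0<r : 0 < r
    0<r with r in r≡0
    ... | suc _ = z<s
    ... | zero  = ⊥-elim (<⇒≢ (s≤s 1≤κ) (sym (coprime (m%n≡0⇒n∣m m K r≡0 , ∣-refl))))

    0<c : 0 < c
    0<c = m<n⇒0<n∸m (m%n<n m K)

    2+q≤m : 2 + q ≤ m
    2+q≤m with q in q≡
    ... | zero   = 2≤m
    ... | suc q′ = begin
      3 + q′              ≤⟨ +-monoʳ-≤ 3 (m≤m*n q′ 2) ⟩
      1 + suc q′ * 2      ≤⟨ +-mono-≤ 0<r (*-monoʳ-≤ (suc q′) (s≤s 1≤κ)) ⟩
      r + suc q′ * K      ≡⟨ cong (λ x → r + x * K) q≡ ⟨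
      r + q * K           ≡⟨ m≡r+q*K ⟨
      m                   ∎
      where open ≤-Reasoning

    m≡q+[2+t] : m ≡ q + (2 + t)
    m≡q+[2+t] = trans (sym (m+[n∸m]≡n 2+q≤m)) (shuffle q t)
      where
      shuffle : ∀ q t → 2 + q + t ≡ q + (2 + t)
      shuffle = solve-∀

    M≡ : M ≡ suc t * K + c
    M≡ = +-cancelʳ-≡ m M _ (begin
      M + m                       ≡⟨ +-comm M m ⟩
      m + m * κ                   ≡⟨ *-suc m κ ⟨
      m * K                       ≡⟨ cong (_* K) m≡q+[2+t] ⟩
      (q + (2 + t)) * K           ≡⟨ cong (λ k → (q + (2 + t)) * k) K≡c+r ⟩
      (q + (2 + t)) * (c + r)     ≡⟨ regroup t q c r ⟩
      suc t * (c + r) + c + (r + q * (c + r))  ≡⟨ cong (λ k → suc t * k + c + (r + q * k)) K≡c+r ⟨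
      suc t * K + c + (r + q * K) ≡⟨ cong (suc t * K + c +_) m≡r+q*K ⟨
      suc t * K + c + m           ∎)
      where
      open ≡-Reasoning
      K≡c+r : K ≡ c + r
      K≡c+r = sym (m∸n+n≡m (<⇒≤ (m%n<n m K)))
      regroup : ∀ t q c r → (q + (2 + t)) * (c + r) ≡ suc t * (c + r) + c + (r + q * (c + r))
      regroup = solve-∀

    M∸K≡ : M ∸ K ≡ t * K + c
    M∸K≡ = trans (cong (_∸ K) (trans M≡ (+-assoc K (t * K) c))) (m+n∸m≡n K (t * K + c))

    0<M∸K : 0 < M ∸ K
    0<M∸K = subst (0 <_) (sym M∸K≡) (<-≤-trans 0<c (m≤n+m c (t * K)))

    K≤M : K ≤ M
    K≤M = subst (K ≤_) (sym (trans M≡ (+-assoc K (t * K) c))) (m≤m+n K _)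

    F-M : F M (M ∸ K) ≡ t + F K c
    F-M = trans (cong₂ F M≡ M∸K≡) (F-arith K c t z<s 0<c)

    ℓ : ℕ
    ℓ = F (M ∸ K) (negMod M (M ∸ K))

    F-M≡suc-ℓ : F M (M ∸ K) ≡ suc ℓ
    F-M≡suc-ℓ = F-suc M 0<M∸K

    length : (m ∸ q) + F K c ≡ 3 + ℓ
    length = begin
      (m ∸ q) + F K c           ≡⟨ cong (λ x → x ∸ q + F K c) m≡q+[2+t] ⟩
      (q + (2 + t) ∸ q) + F K c ≡⟨ cong (_+ F K c) (m+n∸m≡n q (2 + t)) ⟩
      2 + t + F K c             ≡⟨ cong (2 +_) F-M ⟨
      2 + F M (M ∸ K)           ≡⟨ cong (2 +_) F-M≡suc-ℓ ⟩
      3 + ℓ                     ∎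
      where open ≡-Reasoning

    0<M : 0 < M
    0<M = <-≤-trans z<s K≤M

    p : ℕ → ℕ
    p = terms M (M ∸ K)

    p-pos : ∀ j → j ≤ ℓ → 0 < p j
    p-pos j j≤ℓ = terms-pos M (M ∸ K) j 0<M (subst (j <_) (sym F-M≡suc-ℓ) (s≤s j≤ℓ))

    p-beyond : ∀ s → p (s + suc ℓ) ≡ 0
    p-beyond s = terms-0-stable M (M ∸ K) ℓ s (subst (λ j → p j ≡ 0) F-M≡suc-ℓ (terms-F M (M ∸ K)))

    p-decreasing : ∀ j → j < ℓ → p (suc j) < p j
    p-decreasing zero    _   = ∸-monoʳ-< z<s K≤M
    p-decreasing (suc j) j<ℓ = terms-suc-suc< M (M ∸ K) j (p-pos (suc j) (<⇒≤ j<ℓ))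

    Dp : ℕ → ℕ
    Dp j = ceilDiv (p j) (p (suc j))

    Dp-eq : ∀ j → j < ℓ → Dp j * p (suc j) ≡ p j + p (2 + j)
    Dp-eq j j<ℓ = trans (ceilDiv*≡ (p j) (p-pos (suc j) j<ℓ)) (cong (p j +_) (sym (terms-suc-suc M (M ∸ K) j)))

    2≤Dp : ∀ j → j < ℓ → 2 ≤ Dp j
    2≤Dp j j<ℓ = 2≤ceilDiv (p j) (p-pos (suc j) j<ℓ) (p-decreasing j j<ℓ)

module Laplacian where

  open import Data.Nat as ℕ using (ℕ; zero; suc; _≡ᵇ_; z≤n; s≤s)
  import Data.Nat.Properties as ℕP
  open import Data.Integer using (ℤ; +_; -_; _+_; _*_; _-_)
  import Data.Integer.Properties as ℤP
  open import Data.Integer.Tactic.RingSolver using (solve-∀)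
  open import Data.Fin using (Fin; toℕ) renaming (zero to fz; suc to fs)
  open import Data.Bool using (if_then_else_)
  open import Function using (_∘_)
  open import Data.Product using (_,_)
  open import Data.Sum using (inj₁; inj₂)
  open import Data.Empty using (⊥-elim)
  open import Algebra.Properties.AbelianGroup ℤP.+-0-abelianGroup using (∙-cancelʳ)
  open import Relation.Binary.PropositionalEquality
  open import Algebra.Properties.Semiring.Sum ℤP.+-*-semiring using (sum; sum-cong-≗; sum-replicate-zero; ∑-distrib-+; ∑-comm; *-distribˡ-sum)

  sumℤ≡sum : ∀ {n} (f : Fin n → ℤ) → sumℤ f ≡ sum f
  sumℤ≡sum {zero}  f = refl
  sumℤ≡sum {suc n} f = cong (_+_ (f fz)) (sumℤ≡sum (f ∘ fs))

  sum-zero : ∀ {n} (f : Fin n → ℤ) → (∀ i → f i ≡ + 0) → sum f ≡ + 0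
  sum-zero {n} f f≡0 = trans (sum-cong-≗ f≡0) (sum-replicate-zero n)

  -- The Laplacian of D_n at vertex indices in ℕ

  δ : ℕ → ℕ → ℕ
  δ c s = if c ≡ᵇ s then 1 else 0

  edgeCount : ℕ → ℕ → ℕ
  edgeCount 0 s = δ 2 s
  edgeCount 1 s = δ 2 s
  edgeCount 2 s = δ 0 s ℕ.+ (δ 1 s ℕ.+ δ 3 s)
  edgeCount (suc (suc (suc a))) s = δ (2 ℕ.+ a) s ℕ.+ δ (4 ℕ.+ a) s

  ≡ᵇ-sym : ∀ a b → (a ≡ᵇ b) ≡ (b ≡ᵇ a)
  ≡ᵇ-sym zero    zero    = refl
  ≡ᵇ-sym zero    (suc b) = refl
  ≡ᵇ-sym (suc a) zero    = refl
  ≡ᵇ-sym (suc a) (suc b) = ≡ᵇ-sym a b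

  edgeℕ+edgeℕ≡edgeCount : ∀ t s → edgeℕ t s ℕ.+ edgeℕ s t ≡ edgeCount t s
  edgeℕ+edgeℕ≡edgeCount 0 0 = refl
  edgeℕ+edgeℕ≡edgeCount 0 1 = refl
  edgeℕ+edgeℕ≡edgeCount 0 2 = refl
  edgeℕ+edgeℕ≡edgeCount 0 (suc (suc (suc s))) = refl
  edgeℕ+edgeℕ≡edgeCount 1 0 = refl
  edgeℕ+edgeℕ≡edgeCount 1 1 = refl
  edgeℕ+edgeℕ≡edgeCount 1 2 = refl
  edgeℕ+edgeℕ≡edgeCount 1 (suc (suc (suc s))) = refl
  edgeℕ+edgeℕ≡edgeCount 2 0 = refl
  edgeℕ+edgeℕ≡edgeCount 2 1 = refl
  edgeℕ+edgeℕ≡edgeCount 2 2 = refl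
  edgeℕ+edgeℕ≡edgeCount 2 3 = refl
  edgeℕ+edgeℕ≡edgeCount 2 (suc (suc (suc (suc s)))) = refl
  edgeℕ+edgeℕ≡edgeCount (suc (suc (suc a))) 0 = refl
  edgeℕ+edgeℕ≡edgeCount (suc (suc (suc a))) 1 = refl
  edgeℕ+edgeℕ≡edgeCount (suc (suc (suc a))) (suc (suc s)) =
    trans (ℕP.+-comm (δ s (2 ℕ.+ a)) (δ a s))
          (cong (λ b → δ a s ℕ.+ (if b then 1 else 0)) (≡ᵇ-sym s (suc (suc a))))

  nbrSum : (ℕ → ℤ) → ℕ → ℤ
  nbrSum Z 0 = Z 2
  nbrSum Z 1 = Z 2
  nbrSum Z 2 = Z 0 + (Z 1 + Z 3)
  nbrSum Z (suc (suc (suc a))) = Z (2 ℕ.+ a) + Z (4 ℕ.+ a)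

  lapℕ : (ℕ → ℕ) → (ℕ → ℤ) → ℕ → ℤ
  lapℕ D Z t = + D t * Z t - nbrSum Z t

  extend : ∀ {n} → (Fin n → ℤ) → ℕ → ℤ
  extend {zero}  z c       = + 0
  extend {suc n} z zero    = z fz
  extend {suc n} z (suc c) = extend (z ∘ fs) c

  extend-toℕ : ∀ {n} (z : Fin n → ℤ) i → extend z (toℕ i) ≡ z i
  extend-toℕ z fz     = refl
  extend-toℕ z (fs i) = extend-toℕ (z ∘ fs) i

  extend-∘toℕ : ∀ {n} (Z : ℕ → ℤ) → (∀ c → n ℕ.≤ c → Z c ≡ + 0) → ∀ c → extend {n} (Z ∘ toℕ) c ≡ Z c
  extend-∘toℕ {zero}  Z Z≡0 c       = sym (Z≡0 c z≤n)
  extend-∘toℕ {suc n} Z Z≡0 zero    = refl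
  extend-∘toℕ {suc n} Z Z≡0 (suc c) = extend-∘toℕ (Z ∘ suc) (λ c n≤c → Z≡0 (suc c) (s≤s n≤c)) c

  sum-δ : ∀ {n} (z : Fin n → ℤ) c → sum (λ j → + δ c (toℕ j) * z j) ≡ extend z c
  sum-δ {zero}  z c       = refl
  sum-δ {suc n} z zero    =
    trans (cong₂ _+_ (ℤP.*-identityˡ (z fz)) (sum-zero (λ i → + δ zero (toℕ (fs i)) * z (fs i)) (λ _ → refl)))
          (ℤP.+-identityʳ (z fz))
  sum-δ {suc n} z (suc c) = trans (ℤP.+-identityˡ (sum (λ j → + δ (suc c) (toℕ (fs j)) * z (fs j)))) (sum-δ (z ∘ fs) c)

  sum-pos-+ : ∀ {n} (f g : ℕ → ℕ) (z : Fin n → ℤ) →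
            sum (λ j → + (f (toℕ j) ℕ.+ g (toℕ j)) * z j) ≡ sum (λ j → + f (toℕ j) * z j) + sum (λ j → + g (toℕ j) * z j)
  sum-pos-+ f g z = trans (sum-cong-≗ distrib) (∑-distrib-+ (λ j → + f (toℕ j) * z j) (λ j → + g (toℕ j) * z j))
    where
    distrib : ∀ j → + (f (toℕ j) ℕ.+ g (toℕ j)) * z j ≡ + f (toℕ j) * z j + + g (toℕ j) * z j
    distrib j = trans (cong (_* z j) (ℤP.pos-+ (f (toℕ j)) (g (toℕ j)))) (ℤP.*-distribʳ-+ (z j) (+ f (toℕ j)) (+ g (toℕ j)))

  sum-adj≡nbrSum : ∀ {n} (z : Fin n → ℤ) i → sumℤ (λ j → adj i j * z j) ≡ nbrSum (extend z) (toℕ i)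
  sum-adj≡nbrSum z i = begin
    sumℤ (λ j → adj i j * z j)                          ≡⟨ sumℤ≡sum (λ j → adj i j * z j) ⟩
    sum (λ j → adj i j * z j)                           ≡⟨ sum-cong-≗ (λ j → cong (λ e → + e * z j) (edgeℕ+edgeℕ≡edgeCount (toℕ i) (toℕ j))) ⟩
    sum (λ j → + edgeCount (toℕ i) (toℕ j) * z j)       ≡⟨ byVertex (toℕ i) ⟩
    nbrSum (extend z) (toℕ i)                           ∎
    where
    open ≡-Reasoning
    byVertex : ∀ t → sum (λ j → + edgeCount t (toℕ j) * z j) ≡ nbrSum (extend z) t
    byVertex 0 = sum-δ z 2
    byVertex 1 = sum-δ z 2
    byVertex 2 = trans (sum-pos-+ (δ 0) (λ s → δ 1 s ℕ.+ δ 3 s) z)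
                       (cong₂ _+_ (sum-δ z 0) (trans (sum-pos-+ (δ 1) (δ 3) z) (cong₂ _+_ (sum-δ z 1) (sum-δ z 3))))
    byVertex (suc (suc (suc a))) = trans (sum-pos-+ (δ (2 ℕ.+ a)) (δ (4 ℕ.+ a)) z) (cong₂ _+_ (sum-δ z (2 ℕ.+ a)) (sum-δ z (4 ℕ.+ a)))

  lap≡lapℕ : ∀ {n} (D : ℕ → ℕ) (z : Fin n → ℤ) i → lap (D ∘ toℕ) z i ≡ lapℕ D (extend z) (toℕ i)
  lap≡lapℕ D z i = cong₂ (λ x y → + D (toℕ i) * x - y) (sym (extend-toℕ z i)) (sum-adj≡nbrSum z i)

  lap∘toℕ : ∀ {n} (D : ℕ → ℕ) (Z : ℕ → ℤ) → (∀ c → n ℕ.≤ c → Z c ≡ + 0) →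
            ∀ (i : Fin n) → lap (D ∘ toℕ) (Z ∘ toℕ) i ≡ lapℕ D Z (toℕ i)
  lap∘toℕ {n} D Z Z≡0 i =
    trans (lap≡lapℕ D (Z ∘ toℕ) i) (cong₂ (λ x y → + D (toℕ i) * x - y) (ext (toℕ i)) (nbrSum-cong (toℕ i)))
    where
    ext : ∀ c → extend {n} (Z ∘ toℕ) c ≡ Z c
    ext = extend-∘toℕ Z Z≡0
    nbrSum-cong : ∀ t → nbrSum (extend {n} (Z ∘ toℕ)) t ≡ nbrSum Z t
    nbrSum-cong 0 = ext 2
    nbrSum-cong 1 = ext 2
    nbrSum-cong 2 = cong₂ _+_ (ext 0) (cong₂ _+_ (ext 1) (ext 3))
    nbrSum-cong (suc (suc (suc a))) = cong₂ _+_ (ext _) (ext _)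

  -- Self-adjointness

  infix 7 _·_

  _·_ : ∀ {n} → (Fin n → ℤ) → (Fin n → ℤ) → ℤ
  u · v = sum (λ i → u i * v i)

  adj-sym : ∀ {n} (i j : Fin n) → adj i j ≡ adj j i
  adj-sym i j = cong +_ (ℕP.+-comm (edgeℕ (toℕ i) (toℕ j)) (edgeℕ (toℕ j) (toℕ i)))

  ·-lap : ∀ {n} (d : Fin n → ℕ) (u z : Fin n → ℤ) →
           u · lap d z ≡ sum (λ i → u i * (+ d i * z i)) + sum (λ i → sum (λ j → - u i * (adj i j * z j)))
  ·-lap d u z = trans (sum-cong-≗ expand) (∑-distrib-+ (λ i → u i * (+ d i * z i)) (λ i → sum (λ j → - u i * (adj i j * z j))))
    where
    distrib : ∀ u x s → u * (x - s) ≡ u * x + - u * s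
    distrib = solve-∀
    expand : ∀ i → u i * lap d z i ≡ u i * (+ d i * z i) + sum (λ j → - u i * (adj i j * z j))
    expand i = begin
      u i * (+ d i * z i - sumℤ (λ j → adj i j * z j))        ≡⟨ cong (λ s → u i * (+ d i * z i - s)) (sumℤ≡sum (λ j → adj i j * z j)) ⟩
      u i * (+ d i * z i - sum (λ j → adj i j * z j))         ≡⟨ distrib (u i) (+ d i * z i) (sum (λ j → adj i j * z j)) ⟩
      u i * (+ d i * z i) + - u i * sum (λ j → adj i j * z j) ≡⟨ cong (_+_ (u i * (+ d i * z i))) (*-distribˡ-sum (- u i) (λ j → adj i j * z j)) ⟩
      u i * (+ d i * z i) + sum (λ j → - u i * (adj i j * z j)) ∎
      where open ≡-Reasoning

  lap-self-adjoint : ∀ {n} (d : Fin n → ℕ) (u z : Fin n → ℤ) → u · lap d z ≡ z · lap d u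
  lap-self-adjoint d u z = begin
    u · lap d z                                                            ≡⟨ ·-lap d u z ⟩
    sum (λ i → u i * (+ d i * z i)) + sum (λ i → sum (λ j → - u i * (adj i j * z j)))
      ≡⟨ cong₂ _+_ (sum-cong-≗ λ i → diagonal (u i) (+ d i) (z i)) (∑-comm (λ i j → - u i * (adj i j * z j))) ⟩
    sum (λ i → z i * (+ d i * u i)) + sum (λ j → sum (λ i → - u i * (adj i j * z j)))
      ≡⟨ cong (_+_ (sum (λ i → z i * (+ d i * u i)))) (sum-cong-≗ λ j → sum-cong-≗ λ i → offDiagonal i j) ⟩
    sum (λ i → z i * (+ d i * u i)) + sum (λ j → sum (λ i → - z j * (adj j i * u i))) ≡⟨ ·-lap d z u ⟨
    z · lap d u                                                            ∎
    where
    open ≡-Reasoning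
    diagonal : ∀ u d z → u * (d * z) ≡ z * (d * u)
    diagonal = solve-∀
    swap : ∀ u a z → - u * (a * z) ≡ - z * (a * u)
    swap = solve-∀
    offDiagonal : ∀ i j → - u i * (adj i j * z j) ≡ - z j * (adj j i * u i)
    offDiagonal i j = trans (swap (u i) (adj i j) (z j)) (cong (λ a → - z j * (a * u i)) (adj-sym i j))

  ker·lap≡0 : ∀ {n} (d : Fin n → ℕ) (r z : Fin n → ℤ) → (∀ i → lap d r i ≡ + 0) → r · lap d z ≡ + 0
  ker·lap≡0 d r z r∈ker = trans (lap-self-adjoint d r z) (sum-zero _ λ i → trans (cong (z i *_) (r∈ker i)) (ℤP.*-zeroʳ (z i)))

  torsion⟂ker : ∀ {n} (d : Fin n → ℕ) (r v : Fin n → ℤ) → (∀ i → lap d r i ≡ + 0) → Torsion d v → r · v ≡ + 0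
  torsion⟂ker d r v r∈ker (c , 1≤c , z , lap-z≡cv) with ℤP.i*j≡0⇒i≡0∨j≡0 (+ c) cr·v≡0
    where
    scale : ∀ c r v → c * (r * v) ≡ r * (c * v)
    scale = solve-∀
    cr·v≡0 : + c * (r · v) ≡ + 0
    cr·v≡0 = begin
      + c * (r · v)                   ≡⟨ *-distribˡ-sum (+ c) (λ i → r i * v i) ⟩
      sum (λ i → + c * (r i * v i))   ≡⟨ sum-cong-≗ (λ i → trans (scale (+ c) (r i) (v i)) (cong (r i *_) (sym (lap-z≡cv i)))) ⟩
      r · lap d z                     ≡⟨ ker·lap≡0 d r z r∈ker ⟩
      + 0                             ∎
      where open ≡-Reasoning
  ... | inj₁ c≡0 = ⊥-elim (ℕP.<⇒≢ 1≤c (sym (ℤP.+-injective c≡0)))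
  ... | inj₂ r·v≡0 = r·v≡0

  ·-sub : ∀ {n} (r u w : Fin n → ℤ) → r · (λ i → u i - w i) ≡ r · u - r · w
  ·-sub r u w = begin
    sum (λ i → r i * (u i - w i))                ≡⟨ sum-cong-≗ (λ i → split (r i) (u i) (w i)) ⟩
    sum (λ i → r i * u i + - + 1 * (r i * w i))  ≡⟨ ∑-distrib-+ (λ i → r i * u i) _ ⟩
    (r · u) + sum (λ i → - + 1 * (r i * w i))    ≡⟨ cong (_+_ (r · u)) (*-distribˡ-sum (- + 1) (λ i → r i * w i)) ⟨
    (r · u) + - + 1 * (r · w)                    ≡⟨ collect (r · u) (r · w) ⟩
    r · u - r · w                                ∎
    where
    open ≡-Reasoning
    split : ∀ r u w → r * (u - w) ≡ r * u + - + 1 * (r * w)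
    split = solve-∀
    collect : ∀ a b → a + - + 1 * b ≡ a - b
    collect = solve-∀

  -- Pairing with r annihilates the image of lap d, so the row at v_x is determined by the others.
  lap-head : ∀ {n} (d : Fin (suc n) → ℕ) (r z y : Fin (suc n) → ℤ) → (∀ i → lap d r i ≡ + 0) → r fz ≡ + 1 →
             r · y ≡ + 0 → (∀ i → lap d z (fs i) ≡ y (fs i)) → lap d z fz ≡ y fz
  lap-head d r z y r∈ker r₀≡1 r·y≡0 tail≡ = begin
    lap d z fz          ≡⟨ ℤP.*-identityˡ _ ⟨
    + 1 * lap d z fz    ≡⟨ cong (_* lap d z fz) r₀≡1 ⟨
    r fz * lap d z fz   ≡⟨ ∙-cancelʳ (sum (λ i → r (fs i) * y (fs i))) _ _ heads+tail ⟩
    r fz * y fz         ≡⟨ cong (_* y fz) r₀≡1 ⟩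
    + 1 * y fz          ≡⟨ ℤP.*-identityˡ _ ⟩
    y fz                ∎
    where
    open ≡-Reasoning
    heads+tail : r fz * lap d z fz + sum (λ i → r (fs i) * y (fs i)) ≡ r fz * y fz + sum (λ i → r (fs i) * y (fs i))
    heads+tail = begin
      r fz * lap d z fz + sum (λ i → r (fs i) * y (fs i))  ≡⟨ cong (_+_ (r fz * lap d z fz)) (sum-cong-≗ (λ i → cong (r (fs i) *_) (tail≡ i))) ⟨
      r · lap d z                                          ≡⟨ ker·lap≡0 d r z r∈ker ⟩
      + 0                                                  ≡⟨ r·y≡0 ⟨
      r · y                                                ∎

  -- Back-substitution along a path

  -- The equation at the interior vertex s + 1 of a path with vertex values P.
  pathEq : (ℕ → ℕ) → (ℕ → ℤ) → ℕ → ℤ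
  pathEq D P s = + D (suc s) * P (suc s) - (P s + P (suc (suc s)))

  pathSolution : ℕ → (ℕ → ℕ) → (ℕ → ℤ) → ℕ → ℤ
  pathSolution zero    D V j       = + 0
  pathSolution (suc ℓ) D V zero    = + D 1 * P 0 - P 1 - V 0
    where P = pathSolution ℓ (D ∘ suc) (V ∘ suc)
  pathSolution (suc ℓ) D V (suc j) = pathSolution ℓ (D ∘ suc) (V ∘ suc) j

  pathSolution-≥ : ∀ ℓ D V j → ℓ ℕ.≤ j → pathSolution ℓ D V j ≡ + 0
  pathSolution-≥ zero    D V j       _         = refl
  pathSolution-≥ (suc ℓ) D V (suc j) (s≤s ℓ≤j) = pathSolution-≥ ℓ (D ∘ suc) (V ∘ suc) j ℓ≤j

  pathSolution-eq : ∀ ℓ D V s → s ℕ.< ℓ → pathEq D (pathSolution ℓ D V) s ≡ V s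
  pathSolution-eq (suc ℓ) D V zero    _         = solved (+ D 1 * P 0) (P 1) (V 0)
    where
    P = pathSolution ℓ (D ∘ suc) (V ∘ suc)
    solved : ∀ x y v → x - ((x - y - v) + y) ≡ v
    solved = solve-∀
  pathSolution-eq (suc ℓ) D V (suc s) (s≤s s<ℓ) = pathSolution-eq ℓ (D ∘ suc) (V ∘ suc) s s<ℓ

module Structure where

  open import Data.Nat as ℕ using (ℕ; zero; suc; z≤n; s≤s; NonZero)
  import Data.Nat.Properties as ℕP
  open import Data.Nat.Divisibility using (_∣_; divides; ∣⇒≤; ∣1⇒≡1)
  open import Data.Nat.Coprimality using (Coprime; coprime-divisor)
  open import Data.Integer using (ℤ; +_; -_; _+_; _*_; _-_; ∣_∣; _/ℕ_; _%ℕ_)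
  import Data.Integer.Properties as ℤP
  open import Data.Integer.DivMod using (a≡a%ℕn+[a/ℕn]*n; n%ℕd<d)
  open import Data.Integer.Tactic.RingSolver using (solve-∀)
  open import Data.Fin using (Fin; toℕ; fromℕ<) renaming (zero to fz; suc to fs)
  open import Data.Fin.Properties using (toℕ<n; toℕ-fromℕ<; toℕ-injective)
  open import Data.Product using (Σ; _,_)
  open import Data.Sum using (inj₁; inj₂)
  open import Data.Empty using (⊥-elim)
  open import Function using (_∘_)
  open import Relation.Binary.PropositionalEquality
  open Sequence using (module Parameters)
  open Laplacian

  ∣+a-+b∣<m : ∀ {m} a b → a ℕ.< m → b ℕ.< m → ∣ + a - + b ∣ ℕ.< m
  ∣+a-+b∣<m {m} a b a<m b<m with ℕP.≤-total a b
  ... | inj₁ a≤b = subst (ℕ._< m) (sym (trans ∣+a-+b∣≡∣a⊖b∣ (ℤP.∣⊖∣-≤ a≤b))) (ℕP.≤-<-trans (ℕP.m∸n≤m b a) b<m)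
    where ∣+a-+b∣≡∣a⊖b∣ = cong ∣_∣ (ℤP.m-n≡m⊖n a b)
  ... | inj₂ b≤a = subst (ℕ._< m) (sym (trans ∣+a-+b∣≡∣b⊖a∣ (ℤP.∣⊖∣-≤ b≤a))) (ℕP.≤-<-trans (ℕP.m∸n≤m a b) a<m)
    where ∣+a-+b∣≡∣b⊖a∣ = trans (cong ∣_∣ (ℤP.m-n≡m⊖n a b)) (ℤP.∣m⊖n∣≡∣n⊖m∣ a b)

  [a-b]*k≡m*w⇒a≡b : ∀ {m k} a b (w : ℤ) → a ℕ.< m → b ℕ.< m → Coprime m k → (+ a - + b) * + k ≡ + m * w → a ≡ b
  [a-b]*k≡m*w⇒a≡b {m} {k} a b w a<m b<m coprime eq =
    ℤP.+-injective (ℤP.i-j≡0⇒i≡j (+ a) (+ b) (ℤP.∣i∣≡0⇒i≡0 ∣a-b∣≡0))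
    where
    x = ∣ + a - + b ∣
    m∣k*x : m ∣ k ℕ.* x
    m∣k*x = divides ∣ w ∣ (begin
      k ℕ.* x             ≡⟨ ℕP.*-comm k x ⟩
      x ℕ.* k             ≡⟨ ℤP.abs-* (+ a - + b) (+ k) ⟨
      ∣ (+ a - + b) * + k ∣ ≡⟨ cong ∣_∣ eq ⟩
      ∣ + m * w ∣         ≡⟨ ℤP.abs-* (+ m) w ⟩
      m ℕ.* ∣ w ∣         ≡⟨ ℕP.*-comm m ∣ w ∣ ⟩
      ∣ w ∣ ℕ.* m         ∎)
      where open ≡-Reasoning
    ∣a-b∣≡0 : x ≡ 0
    ∣a-b∣≡0 with x in x≡ | coprime-divisor coprime m∣k*x
    ... | zero  | _   = refl
    ... | suc _ | m∣x = ⊥-elim (ℕP.<⇒≱ (subst (ℕ._< m) x≡ (∣+a-+b∣<m a b a<m b<m)) (∣⇒≤ m∣x))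

  pos-diff≡0 : ∀ {x y : ℕ} {X Y : ℤ} → X ≡ + x → Y ≡ + y → x ≡ y → X - Y ≡ + 0
  pos-diff≡0 {x} refl refl refl = ℤP.+-inverseʳ (+ x)

  module Construction (m κ : ℕ) (2≤m : 2 ℕ.≤ m) (1≤κ : 1 ℕ.≤ κ) (coprime : Coprime m (suc κ)) where
    open Parameters m κ 2≤m 1≤κ coprime public hiding (r)

    n : ℕ
    n = 3 ℕ.+ ℓ

    Dn Rn : ℕ → ℕ
    Dn 0 = M
    Dn 1 = m
    Dn 2 = 1
    Dn (suc (suc (suc i))) = Dp i
    Rn 0 = 1
    Rn 1 = κ
    Rn (suc (suc j)) = p j

    d : Fin n → ℕ
    d = Dn ∘ toℕ

    r : Fin n → ℤ
    r = +_ ∘ Rn ∘ toℕ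

    2≤Dn : ∀ t → t ℕ.< n → t ≢ 2 → 2 ℕ.≤ Dn t
    2≤Dn 0 _ _ = ℕP.*-mono-≤ 2≤m 1≤κ
    2≤Dn 1 _ _ = 2≤m
    2≤Dn 2 _ 2≢2 = ⊥-elim (2≢2 refl)
    2≤Dn (suc (suc (suc i))) (s≤s (s≤s (s≤s i<ℓ))) _ = 2≤Dp i i<ℓ

    1≤Dn : ∀ t → t ℕ.< n → 1 ℕ.≤ Dn t
    1≤Dn 2 _ = s≤s z≤n
    1≤Dn 0 t<n = ℕP.≤-trans (s≤s z≤n) (2≤Dn 0 t<n (λ ()))
    1≤Dn 1 t<n = ℕP.≤-trans (s≤s z≤n) (2≤Dn 1 t<n (λ ()))
    1≤Dn (suc (suc (suc i))) t<n = ℕP.≤-trans (s≤s z≤n) (2≤Dn _ t<n (λ ()))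

    1≤Rn : ∀ t → t ℕ.< n → 1 ℕ.≤ Rn t
    1≤Rn 0 _ = s≤s z≤n
    1≤Rn 1 _ = 1≤κ
    1≤Rn (suc (suc j)) (s≤s (s≤s j≤ℓ)) = p-pos j (ℕP.≤-pred j≤ℓ)

    Rn-≥n : ∀ c → n ℕ.≤ c → + Rn c ≡ + 0
    Rn-≥n (suc (suc j)) (s≤s (s≤s ℓ<j)) = cong +_ (trans (cong p (sym (ℕP.m∸n+n≡m ℓ<j))) (p-beyond (j ℕ.∸ suc ℓ)))

    lapℕ-Rn : ∀ t → t ℕ.< n → lapℕ Dn (+_ ∘ Rn) t ≡ + 0
    lapℕ-Rn 0 _ = pos-diff≡0 (sym (ℤP.pos-* M 1)) refl (ℕP.*-identityʳ M)
    lapℕ-Rn 1 _ = pos-diff≡0 (sym (ℤP.pos-* m κ)) refl refl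
    lapℕ-Rn 2 _ = pos-diff≡0 (sym (ℤP.pos-* 1 M)) (sym (trans (ℤP.pos-+ 1 (κ ℕ.+ p 1)) (cong (_+_ (+ 1)) (ℤP.pos-+ κ (p 1)))))
                             (trans (ℕP.*-identityˡ M) (sym (ℕP.m+[n∸m]≡n K≤M)))
    lapℕ-Rn (suc (suc (suc s))) (s≤s (s≤s (s≤s s<ℓ))) =
      pos-diff≡0 (sym (ℤP.pos-* (Dp s) (p (suc s)))) (sym (ℤP.pos-+ (p s) (p (2 ℕ.+ s)))) (Dp-eq s s<ℓ)

    lap-r≡0 : ∀ i → lap d r i ≡ + 0
    lap-r≡0 i = trans (lap∘toℕ Dn (+_ ∘ Rn) Rn-≥n i) (lapℕ-Rn (toℕ i) (toℕ<n i))

    S : ArithStruct n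
    S = record
      { d           = d
      ; r           = Rn ∘ toℕ
      ; d-pos       = λ i → 1≤Dn (toℕ i) (toℕ<n i)
      ; r-pos       = λ i → 1≤Rn (toℕ i) (toℕ<n i)
      ; kernel      = lap-r≡0
      ; r-primitive = λ g g∣r → ∣1⇒≡1 (g∣r fz)
      }

    smooth : Smooth S
    smooth i i≢2 = 2≤Dn (toℕ i) (toℕ<n i) i≢2

    -- The class of W generates the critical group.
    W : ℕ → ℤ
    W 0 = - + κ
    W 1 = + 1
    W (suc (suc _)) = + 0

    E : ℕ → ℕ → ℤ
    E a 0 = - + a
    E a 1 = + a
    E a (suc (suc _)) = + 0

    rep : Fin m → Fin n → ℤ
    rep a i = + toℕ a * W (toℕ i)

    lapℕ-E : ∀ a t → lapℕ Dn (E a) t ≡ + m * (+ a * W t)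
    lapℕ-E a 0 = trans (cong (λ x → x * - + a - + 0) (ℤP.pos-* m κ)) (atVx (+ m) (+ κ) (+ a))
      where
      atVx : ∀ m κ a → m * κ * - a - + 0 ≡ m * (a * - κ)
      atVx = solve-∀
    lapℕ-E a 1 = atVy (+ m) (+ a)
      where
      atVy : ∀ m a → m * a - + 0 ≡ m * (a * + 1)
      atVy = solve-∀
    lapℕ-E a 2 = atV0 (+ m) (+ a)
      where
      atV0 : ∀ m a → + 1 * + 0 - (- a + (a + + 0)) ≡ m * (a * + 0)
      atV0 = solve-∀
    lapℕ-E a (suc (suc (suc i))) = onPath (+ Dp i) (+ m) (+ a)
      where
      onPath : ∀ d m a → d * + 0 - (+ 0 + + 0) ≡ m * (a * + 0)
      onPath = solve-∀

    rep-torsion : ∀ a → Torsion d (rep a)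
    rep-torsion a = m , ℕP.≤-trans (s≤s z≤n) 2≤m , E (toℕ a) ∘ toℕ , λ i →
      trans (lap∘toℕ Dn (E (toℕ a)) E-≥n i) (lapℕ-E (toℕ a) (toℕ i))
      where
      E-≥n : ∀ c → n ℕ.≤ c → E (toℕ a) c ≡ + 0
      E-≥n 0 ()
      E-≥n 1 (s≤s ())
      E-≥n (suc (suc c)) _ = refl

    -- Subtracting the rows at v_x and v_y eliminates Z 2, leaving (a − b) k = m (Z 1 − κ Z 0).
    rep-injective : ∀ a b → SameClass d (rep a) (rep b) → a ≡ b
    rep-injective a b (z , lap-z≡) =
      toℕ-injective ([a-b]*k≡m*w⇒a≡b (toℕ a) (toℕ b) (Z 1 - + κ * Z 0) (toℕ<n a) (toℕ<n b) coprime (begin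
        (+ α - + β) * + K                                ≡⟨ cong ((+ α - + β) *_) (ℤP.pos-+ 1 κ) ⟩
        (+ α - + β) * (+ 1 + + κ)                        ≡⟨ expand (+ α) (+ β) (+ κ) ⟩
        (+ α * + 1 - + β * + 1) - (+ α * - + κ - + β * - + κ) ≡⟨ cong₂ _-_ rowVy rowVx ⟨
        (+ m * Z 1 - Z 2) - (+ M * Z 0 - Z 2)            ≡⟨ cong (λ x → (+ m * Z 1 - Z 2) - (x * Z 0 - Z 2)) (ℤP.pos-* m κ) ⟩
        (+ m * Z 1 - Z 2) - (+ m * + κ * Z 0 - Z 2)      ≡⟨ collect (+ m) (+ κ) (Z 0) (Z 1) (Z 2) ⟩
        + m * (Z 1 - + κ * Z 0)                          ∎))
      where
      open ≡-Reasoning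
      α = toℕ a
      β = toℕ b
      Z = extend z
      rowVx : lapℕ Dn Z 0 ≡ + α * W 0 - + β * W 0
      rowVx = trans (sym (lap≡lapℕ Dn z fz)) (lap-z≡ fz)
      rowVy : lapℕ Dn Z 1 ≡ + α * W 1 - + β * W 1
      rowVy = trans (sym (lap≡lapℕ Dn z (fs fz))) (lap-z≡ (fs fz))
      expand : ∀ a b κ → (a - b) * (+ 1 + κ) ≡ (a * + 1 - b * + 1) - (a * - κ - b * - κ)
      expand = solve-∀
      collect : ∀ m κ z₀ z₁ z₂ → (m * z₁ - z₂) - (m * κ * z₀ - z₂) ≡ m * (z₁ - κ * z₀)
      collect = solve-∀

    rep-surjective : ∀ v → Torsion d v → Σ (Fin m) λ a → SameClass d v (rep a)
    rep-surjective v v-torsion = a , Z ∘ toℕ , lap-Z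
      where
      instance
        m≢0 : NonZero m
        m≢0 = ℕ.>-nonZero (ℕP.≤-trans (s≤s z≤n) 2≤m)
      V : ℕ → ℤ
      V = extend v
      P : ℕ → ℤ
      P = pathSolution ℓ (Dn ∘ (2 ℕ.+_)) (λ s → V (3 ℕ.+ s))
      -- Solve the rows of the path, then of v_y (fixing a ≡ Y mod m), then of v_0;
      -- the row at v_x then holds by lap-head.
      Y β : ℤ
      Y = V 1 + P 0
      β = Y /ℕ m
      a : Fin m
      a = fromℕ< (n%ℕd<d Y m)
      Z : ℕ → ℤ
      Z 0 = P 0 - β - P 1 - V 2
      Z 1 = β
      Z (suc (suc j)) = P j

      Z-≥n : ∀ c → n ℕ.≤ c → Z c ≡ + 0
      Z-≥n (suc (suc j)) (s≤s (s≤s ℓ<j)) = pathSolution-≥ ℓ _ _ j (ℕP.<⇒≤ ℓ<j)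

      lapℕ-Z : ∀ t → 1 ℕ.≤ t → t ℕ.< n → lapℕ Dn Z t ≡ V t - + (Y %ℕ m) * W t
      lapℕ-Z 1 _ _ = begin
        + m * β - P 0                              ≡⟨ reorder (+ m) β (P 0) (+ (Y %ℕ m)) ⟩
        (+ (Y %ℕ m) + β * + m) - P 0 - + (Y %ℕ m)  ≡⟨ cong (λ y → y - P 0 - + (Y %ℕ m)) (a≡a%ℕn+[a/ℕn]*n Y m) ⟨
        (V 1 + P 0) - P 0 - + (Y %ℕ m)             ≡⟨ cancel (V 1) (P 0) (+ (Y %ℕ m)) ⟩
        V 1 - + (Y %ℕ m) * + 1                     ∎
        where
        open ≡-Reasoning
        reorder : ∀ m β p a → m * β - p ≡ (a + β * m) - p - a
        reorder = solve-∀
        cancel : ∀ v p a → (v + p) - p - a ≡ v - a * + 1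
        cancel = solve-∀
      lapℕ-Z 2 _ _ = atV0 (P 0) β (P 1) (V 2) (+ (Y %ℕ m))
        where
        atV0 : ∀ p₀ β p₁ v a → + 1 * p₀ - ((p₀ - β - p₁ - v) + (β + p₁)) ≡ v - a * + 0
        atV0 = solve-∀
      lapℕ-Z (suc (suc (suc s))) _ (s≤s (s≤s (s≤s s<ℓ))) =
        trans (pathSolution-eq ℓ (Dn ∘ (2 ℕ.+_)) (λ s → V (3 ℕ.+ s)) s s<ℓ) (onPath (V (3 ℕ.+ s)) (+ (Y %ℕ m)))
        where
        onPath : ∀ v a → v ≡ v - a * + 0
        onPath = solve-∀

      lap-Z-tail : ∀ i → lap d (Z ∘ toℕ) (fs i) ≡ v (fs i) - rep a (fs i)
      lap-Z-tail i = trans (lap∘toℕ Dn Z Z-≥n (fs i)) (trans (lapℕ-Z (suc (toℕ i)) (s≤s z≤n) (toℕ<n (fs i)))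
        (cong₂ (λ x k → x - + k * W (suc (toℕ i))) (extend-toℕ v (fs i)) (sym (toℕ-fromℕ< (n%ℕd<d Y m)))))

      r·[v-rep]≡0 : r · (λ i → v i - rep a i) ≡ + 0
      r·[v-rep]≡0 = trans (·-sub r v (rep a))
        (cong₂ _-_ (torsion⟂ker d r v lap-r≡0 v-torsion) (torsion⟂ker d r (rep a) lap-r≡0 (rep-torsion a)))

      lap-Z : ∀ i → lap d (Z ∘ toℕ) i ≡ v i - rep a i
      lap-Z fz     = lap-head d r (Z ∘ toℕ) (λ i → v i - rep a i) lap-r≡0 refl r·[v-rep]≡0 lap-Z-tail
      lap-Z (fs i) = lap-Z-tail i

    criticalGroupOrder : CriticalGroupOrder S m
    criticalGroupOrder = rep , rep-torsion , rep-injective , rep-surjective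

open Structure using (module Construction)
open import Data.Nat using (ℕ; _≤_; _+_; _∸_; NonZero; suc; s≤s)
open import Data.Nat.DivMod using (_/_; _%_)
open import Data.Nat.Coprimality using (Coprime)
open import Data.Product using (Σ; _×_; _,_)
open import Relation.Binary.PropositionalEquality using (_≡_; subst; sym; trans)

theorem5p9 : (m k : ℕ) → 2 ≤ m → 2 ≤ k → Coprime m k → .{{_ : NonZero k}} →
    (n : ℕ) → n ≡ (m ∸ m / k) + F k (k ∸ m % k) →
    Σ (ArithStruct n) λ S → Smooth S × CriticalGroupOrder S m
theorem5p9 m (suc κ) 2≤m (s≤s 1≤κ) coprime n n≡ =
  subst (λ n → Σ (ArithStruct n) λ S → Smooth S × CriticalGroupOrder S m) (sym (trans n≡ length))
        (S , smooth , criticalGroupOrder)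
  where open Construction m κ 2≤m 1≤κ coprime
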